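{- Let $G=H_1\times\cdots\times H_r$ be a finite abelian group that is the product of $p_i$-groups $H_i$, where $p_1<p_2<\cdots<p_r$ are primes. Then for every integer $k\ge 2$, $f^{(D)}_G(k)\le\min\{f^{(D)}_{H_i}(k):1\le i\le r\}$. In particular, if $G=\mathbb{Z}_p\times H$ is a finite abelian group with $p$ prime and $p\nmid|H|$, then for every integer $k\ge2$, $f^{(D)}_G(k)\le f^{(D)}(p,k)$.
   Context: For a finite abelian group $G$ (written additively) and a non-empty set $A\subseteq\mathbb{Z}\setminus\{0\}$, the weighted Davenport constant $D_A(G)$ is the least positive integer $k$ such that for every sequence $(x_1,\ldots,x_k)$ of elements of $G$ there exist a non-empty subsequence $(x_{i_1},\ldots,x_{i_t})$ and elements $a_1,\ldots,a_t\in A$ with $\sum_{j=1}^t a_jx_{i_j}=0$. For $G$ of exponent $n$ and an integer $k\ge 2$, $f^{(D)}_G(k):=\min\{|A|:\emptyset\ne A\subseteq[1,n-1],\ D_A(G)\le k\}$ (and $\infty$ if no such $A$ exists). For the cyclic group $\mathbb{Z}_n$ write $f^{(D)}(n,k):=f^{(D)}_{\mathbb{Z}_n}(k)$. -}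

module Defs where

open import Level using (0ℓ)
open import Algebra.Bundles using (AbelianGroup)
open import Data.Nat using (ℕ; zero; suc; _≤_; _<_; _∸_; _^_)
open import Data.Fin using (Fin)
import Data.Fin as Fin
open import Data.List using (List; []; length)
open import Data.List.Relation.Unary.All using (All)
open import Data.List.Relation.Unary.Any using (Any)
open import Data.List.Relation.Unary.AllPairs using (AllPairs)
open import Data.List.Relation.Unary.Unique.Propositional using (Unique)
open import Data.List.Membership.Propositional using (_∈_)
open import Data.Maybe using (Maybe; just; nothing)
open import Data.Product using (Σ; ∃; ∃-syntax; _×_)
open import Relation.Nullary using (¬_)
open import Relation.Binary.PropositionalEquality using (_≡_; _≢_)

record FiniteAbelianGroup : Set₁ where
  field
    abGroup  : AbelianGroup 0ℓ 0ℓ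
  open AbelianGroup abGroup public
  field
    elems    : List Carrier
    complete : ∀ x → Any (x ≈_) elems
    distinct : AllPairs (λ x y → ¬ (x ≈ y)) elems

  0# : Carrier
  0# = ε

  infixl 6 _+_
  _+_ : Carrier → Carrier → Carrier
  _+_ = _∙_


module _ (G : FiniteAbelianGroup) where
  open FiniteAbelianGroup G

  order : ℕ
  order = length elems

  infixr 8 _·_
  _·_ : ℕ → Carrier → Carrier
  zero  · x = 0#
  suc a · x = x + (a · x)

  sumFin : (L : ℕ) → (Fin L → Carrier) → Carrier
  sumFin zero    f = 0#
  sumFin (suc L) f = f Fin.zero + sumFin L (λ j → f (Fin.suc j))

  IsExponent : ℕ → Set
  IsExponent n = (1 ≤ n) × (∀ x → n · x ≈ 0#)
               × (∀ m → 1 ≤ m → (∀ x → m · x ≈ 0#) → n ≤ m)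

  IsPGroup : ℕ → Set
  IsPGroup p = ∃[ e ] order ≡ p ^ e

  IsCyclicOfOrder : ℕ → Set
  IsCyclicOfOrder n = (order ≡ n) × (∃[ g ] ∀ x → ∃[ j ] x ≈ j · g)

  -- The sequence x = (x_1,…,x_L) has a non-empty subsequence with weights
  -- from A summing to 0. A selection w assigns to each index either
  -- `nothing` (index not in the subsequence) or `just a` with a ∈ A.
  term : {L : ℕ} → (Fin L → Maybe ℕ) → (Fin L → Carrier) → Fin L → Carrier
  term w x j with w j
  ... | nothing = 0#
  ... | just a  = a · x j

  HasWeightedZeroSubsum : List ℕ → (L : ℕ) → (Fin L → Carrier) → Set
  HasWeightedZeroSubsum A L x =
    Σ (Fin L → Maybe ℕ) λ w →
      (∃[ j ] ∃[ a ] w j ≡ just a)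
      × (∀ j a → w j ≡ just a → a ∈ A)
      × (sumFin L (term w x) ≈ 0#)

  DavenportProp : List ℕ → ℕ → Set
  DavenportProp A k = ∀ (x : Fin k → Carrier) → HasWeightedZeroSubsum A k x

  -- D_A(G) ≤ k, where D_A(G) is the least positive integer with DavenportProp
  -- (the least such integer is ≤ k iff some such positive integer is ≤ k).
  D≤ : List ℕ → ℕ → Set
  D≤ A k = ∃[ k' ] (1 ≤ k') × (k' ≤ k) × DavenportProp A k'

  -- f^(D)_G(k) ≤ m, for G of exponent n:
  -- some non-empty A ⊆ [1, n-1] with |A| ≤ m has D_A(G) ≤ k.
  -- (f^(D)_G(k) = ∞ exactly when no m satisfies this.)
  fD≤ : (n k m : ℕ) → Set
  fD≤ n k m = ∃[ A ] (A ≢ []) × Unique A × All (λ a → (1 ≤ a) × (a ≤ n ∸ 1)) A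
                     × (length A ≤ m) × D≤ A k

-- G ≅ H_1 × ⋯ × H_r : a bijective additive map G → ∏_i H_i
-- (equality in the product is componentwise).
IsProductOf : (G : FiniteAbelianGroup) {r : ℕ} → (Fin r → FiniteAbelianGroup) → Set
IsProductOf G {r} H =
  Σ ((i : Fin r) → G.Carrier → FiniteAbelianGroup.Carrier (H i)) λ φ →
      (∀ i {x y} → x G.≈ y → FiniteAbelianGroup._≈_ (H i) (φ i x) (φ i y))
    × (∀ i x y → FiniteAbelianGroup._≈_ (H i) (φ i (x G.+ y))
                   (FiniteAbelianGroup._+_ (H i) (φ i x) (φ i y)))
    × (∀ x y → (∀ i → FiniteAbelianGroup._≈_ (H i) (φ i x) (φ i y)) → x G.≈ y)
    × (∀ (t : (i : Fin r) → FiniteAbelianGroup.Carrier (H i)) →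
         ∃[ x ] ∀ i → FiniteAbelianGroup._≈_ (H i) (φ i x) (t i))
  where module G = FiniteAbelianGroup G

pair : FiniteAbelianGroup → FiniteAbelianGroup → Fin 2 → FiniteAbelianGroup
pair C H Fin.zero       = C
pair C H (Fin.suc _)    = H

module Submission where

-- Let G ≅ H₁ × ⋯ × Hᵣ where |Hᵢ| is coprime to every other |Hₗ| (p-groups for distinct
-- primes, or ℤ_p × H with p ∤ |H|), and let n be the exponent of G.  By the Chinese
-- remainder theorem some integer c satisfies c ≡ 1 (mod |Hᵢ|) and c ≡ 0 (mod |Hₗ|) for
-- l ≠ i, so by Lagrange's theorem c acts as the identity on Hᵢ and as 0 on every other
-- factor.  A weight set A ⊆ [1, B - 1] with D_A(Hᵢ) ≤ k is sent to {(c·a) mod n : a ∈ A}: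
-- for a sequence x in G, an A-weighted zero subsum of the i-th coordinates of x becomes,
-- with the weights (c·a) mod n, a subsum vanishing in every coordinate, hence in G.  Since
-- no weight in [1, B - 1] annihilates Hᵢ (B the exponent of Hᵢ, resp. B = p for Hᵢ = ℤ_p),
-- a ↦ (c·a) mod n is injective on A with values in [1, n - 1], so the new set has size |A|.

open import Defs
open import Data.Nat using (ℕ; _≤_; _<_)
open import Data.Nat.Divisibility using (_∣_)
open import Data.Nat.Primality using (Prime)
open import Data.Fin using (Fin)
import Data.Fin as Fin
open import Data.Product using (_×_)
open import Relation.Nullary using (¬_)

open import Data.Nat using (zero; suc; _+_; _*_; _∸_; _^_; NonZero; >-nonZero; nonTrivial⇒n>1; s≤s; z≤n)
open import Data.Nat.Properties
  using (*-assoc; <-cmp; <⇒≢; <⇒≤; <⇒≱; <⇒≤pred; n≢0⇒n>0; m∸n+n≡m; m<n⇒0<n∸m; m∸n≤m; ≤-trans)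
open import Data.Nat.DivMod using (_%_; _/_; m≡m%n+[m/n]*n; m%n<n; [m+kn]%n≡m%n)
open import Data.Nat.Divisibility using (divides; ∣-trans; n∣m*n; m∣m*n)
open import Data.Nat.Coprimality using (Coprime; coprime-divisor; coprime-Bézout; 1-coprimeTo; prime⇒coprime)
import Data.Nat.Coprimality as Coprimality
open import Data.Nat.GCD using (module Bézout)
open import Data.Nat.Primality using (prime; prime⇒irreducible; prime⇒nonZero)
open import Data.Nat.Tactic.RingSolver using (solve-∀)
import Data.Fin.Properties as FinP
open import Data.Fin.Permutation using (Permutation; permutation)
open import Data.Vec.Functional using (removeAt)
open import Data.List using (List; []; _∷_; length; lookup; map)
open import Data.List.Properties using (length-map)
open import Data.List.Membership.Propositional using (_∈_)
open import Data.List.Membership.Propositional.Properties using (∈-lookup; ∈-map⁺)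
open import Data.List.Relation.Unary.All using (All; []; _∷_)
import Data.List.Relation.Unary.All as All
import Data.List.Relation.Unary.All.Properties as All
open import Data.List.Relation.Unary.Any using (Any)
import Data.List.Relation.Unary.Any as Any
open import Data.List.Relation.Unary.Any.Properties using (lookup-index)
open import Data.List.Relation.Unary.AllPairs using (AllPairs; []; _∷_)
open import Data.List.Relation.Unary.Unique.Propositional using (Unique)
open import Data.Maybe using (Maybe; just; nothing)
import Data.Maybe as Maybe
open import Data.Empty using (⊥-elim)
open import Data.Sum using (inj₁; inj₂)
open import Data.Product using (∃-syntax; _,_)
open import Relation.Nullary using (yes; no)
open import Relation.Binary using (Setoid; tri<; tri≈; tri>)
import Relation.Binary.PropositionalEquality as ≡
open ≡ using (_≡_; _≢_)

open Bézout.Identity using (+-; -+)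

-- the polynomial identities behind (-1)² ≡ 1 in the proof of crt
square-of-successor : ∀ t → t * t + 2 * (1 + t) ≡ 1 + (1 + t) * (1 + t)
square-of-successor = solve-∀

square-of-product : ∀ x p → (x * p) * (x * p) ≡ (x * x * p) * p
square-of-product = solve-∀

-- Chinese remainder theorem, in the form needed here: for coprime P and Q some
-- multiple of Q is congruent to 1 modulo P.  From Bézout, either 1 + xP = yQ and
-- c = yQ works, or 1 + yQ = xP, so yQ ≡ -1 and c = (yQ)² works.
crt : ∀ P Q .{{_ : NonZero P}} → Coprime P Q → ∃[ c ] (c % P ≡ 1 % P) × (Q ∣ c)
crt P Q cop with coprime-Bézout cop
... | -+ x y 1+xP≡yQ = y * Q , yQ≡1 , n∣m*n y
  where
  open ≡.≡-Reasoning
  yQ≡1 : (y * Q) % P ≡ 1 % P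
  yQ≡1 = begin
    (y * Q) % P      ≡⟨ ≡.cong (_% P) (≡.sym 1+xP≡yQ) ⟩
    (1 + x * P) % P  ≡⟨ [m+kn]%n≡m%n 1 x P ⟩
    1 % P            ∎
... | +- x y 1+yQ≡xP = T * T , T²≡1 , ∣-trans (n∣m*n y) (m∣m*n T)
  where
  T : ℕ
  T = y * Q
  open ≡.≡-Reasoning
  square-identity : T * T + (2 * x) * P ≡ 1 + (x * x * P) * P
  square-identity = begin
    T * T + (2 * x) * P          ≡⟨ ≡.cong (T * T +_) (*-assoc 2 x P) ⟩
    T * T + 2 * (x * P)          ≡⟨ ≡.cong (λ u → T * T + 2 * u) (≡.sym 1+yQ≡xP) ⟩
    T * T + 2 * (1 + T)          ≡⟨ square-of-successor T ⟩
    1 + (1 + T) * (1 + T)        ≡⟨ ≡.cong (λ u → 1 + u * u) 1+yQ≡xP ⟩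
    1 + (x * P) * (x * P)        ≡⟨ ≡.cong (1 +_) (square-of-product x P) ⟩
    1 + (x * x * P) * P          ∎
  T²≡1 : (T * T) % P ≡ 1 % P
  T²≡1 = begin
    (T * T) % P                    ≡⟨ ≡.sym ([m+kn]%n≡m%n (T * T) (2 * x) P) ⟩
    (T * T + (2 * x) * P) % P      ≡⟨ ≡.cong (_% P) square-identity ⟩
    (1 + (x * x * P) * P) % P      ≡⟨ [m+kn]%n≡m%n 1 (x * x * P) P ⟩
    1 % P                          ∎

coprime-*ˡ : ∀ {a b c} → Coprime a c → Coprime b c → Coprime (a * b) c
coprime-*ˡ a⊥c b⊥c (d∣ab , d∣c) = b⊥c (coprime-divisor d⊥a d∣ab , d∣c)
  where
  d⊥a : Coprime _ _
  d⊥a (e∣d , e∣a) = a⊥c (e∣a , ∣-trans e∣d d∣c)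

coprime-^ˡ : ∀ {a c} → Coprime a c → ∀ e → Coprime (a ^ e) c
coprime-^ˡ a⊥c zero    = 1-coprimeTo _
coprime-^ˡ a⊥c (suc e) = coprime-*ˡ a⊥c (coprime-^ˡ a⊥c e)

prime>1 : ∀ {p} → Prime p → 1 < p
prime>1 {p} (prime _) = nonTrivial⇒n>1 p

prime⊥ : ∀ {p q} → Prime p → ¬ (p ∣ q) → Coprime p q
prime⊥ {p} {q} p-prime p∤q (d∣p , d∣q) with prime⇒irreducible p-prime d∣p
... | inj₁ d≡1 = d≡1
... | inj₂ ≡.refl = ⊥-elim (p∤q d∣q)

distinct-primes⊥ : ∀ {p q} → Prime p → Prime q → p ≢ q → Coprime p q
distinct-primes⊥ {p} p-prime q-prime p≢q = prime⊥ p-prime p∤q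
  where
  p∤q : ¬ (p ∣ _)
  p∤q p∣q with prime⇒irreducible q-prime p∣q
  ... | inj₁ p≡1 = <⇒≢ (prime>1 p-prime) (≡.sym p≡1)
  ... | inj₂ p≡q = p≢q p≡q

increasing⇒injective : ∀ {r} (p : Fin r → ℕ) → (∀ i j → i Fin.< j → p i < p j) →
                       ∀ {i j} → i ≢ j → p i ≢ p j
increasing⇒injective p increasing {i} {j} i≢j with FinP.<-cmp i j
... | tri< i<j _ _ = <⇒≢ (increasing i j i<j)
... | tri≈ _ i≡j _ = ⊥-elim (i≢j i≡j)
... | tri> _ _ j<i = λ pi≡pj → <⇒≢ (increasing j i j<i) (≡.sym pi≡pj)

∏ : ∀ {r} → (Fin r → ℕ) → ℕ
∏ {zero}  g = 1
∏ {suc r} g = g Fin.zero * ∏ (λ j → g (Fin.suc j))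

∣-∏ : ∀ {r} (g : Fin r → ℕ) j → g j ∣ ∏ g
∣-∏ g Fin.zero    = m∣m*n _
∣-∏ g (Fin.suc j) = ∣-trans (∣-∏ (λ j → g (Fin.suc j)) j) (n∣m*n (g Fin.zero))

⊥-∏ : ∀ {a r} (g : Fin r → ℕ) → (∀ j → Coprime a (g j)) → Coprime a (∏ g)
⊥-∏ {r = zero}  g a⊥g = Coprimality.sym (1-coprimeTo _)
⊥-∏ {r = suc r} g a⊥g = Coprimality.sym (coprime-*ˡ (Coprimality.sym (a⊥g Fin.zero))
                          (Coprimality.sym (⊥-∏ (λ j → g (Fin.suc j)) (λ j → a⊥g (Fin.suc j)))))

InRange : ℕ → ℕ → Set
InRange B a = (1 ≤ a) × (a ≤ B ∸ 1)

inRange⇒< : ∀ {B a} → InRange B a → a < B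
inRange⇒< {suc B} {suc a} (_ , a≤B) = s≤s a≤B

difference-range : ∀ {B a b} → a < b → InRange B b → InRange B (b ∸ a)
difference-range {a = a} {b} a<b (_ , b≤) = m<n⇒0<n∸m a<b , ≤-trans (m∸n≤m b a) b≤

lookup-injective : ∀ {a ℓ} (S : Setoid a ℓ) → let open Setoid S in
                   ∀ (xs : List Carrier) → AllPairs (λ x y → ¬ (x ≈ y)) xs →
                   ∀ {i j} → lookup xs i ≈ lookup xs j → i ≡ j
lookup-injective S (x ∷ xs) (_ ∷ _) {Fin.zero} {Fin.zero} _ = ≡.refl
lookup-injective S (x ∷ xs) (x∉xs ∷ _) {Fin.zero} {Fin.suc j} x≈xⱼ =
  ⊥-elim (All.lookup x∉xs (∈-lookup j) x≈xⱼ)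
lookup-injective S (x ∷ xs) (x∉xs ∷ _) {Fin.suc i} {Fin.zero} xᵢ≈x =
  ⊥-elim (All.lookup x∉xs (∈-lookup i) (Setoid.sym S xᵢ≈x))
lookup-injective S (x ∷ xs) (_ ∷ distinct) {Fin.suc i} {Fin.suc j} xᵢ≈xⱼ =
  ≡.cong Fin.suc (lookup-injective S xs distinct xᵢ≈xⱼ)

any⇒nonZero : ∀ {a p} {A : Set a} {P : A → Set p} {xs : List A} → Any P xs → NonZero (length xs)
any⇒nonZero {xs = _ ∷ _} _ = _

map-unique : ∀ {a b p} {A : Set a} {B : Set b} {P : A → Set p} {f : A → B} →
             (∀ {x y} → P x → P y → f x ≡ f y → x ≡ y) →
             ∀ {xs} → All P xs → Unique xs → Unique (map f xs)
map-unique f-inj []         []             = []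
map-unique f-inj (px ∷ pxs) (x∉xs ∷ xs!) =
  All.map⁺ (All.zipWith (λ (py , x≢y) fx≡fy → x≢y (f-inj px py fx≡fy)) (pxs , x∉xs))
  ∷ map-unique f-inj pxs xs!

map-≢[] : ∀ {a b} {A : Set a} {B : Set b} {f : A → B} {xs : List A} → xs ≢ [] → map f xs ≢ []
map-≢[] {xs = []}    xs≢[] _ = xs≢[] ≡.refl
map-≢[] {xs = _ ∷ _} _     ()

module _ (G : FiniteAbelianGroup) where
  open FiniteAbelianGroup G

  Annihilates : ℕ → Set
  Annihilates c = ∀ x → _·_ G c x ≈ 0#

  Fixes : ℕ → Set
  Fixes c = ∀ x → _·_ G c x ≈ x

  Faithful : ℕ → Set
  Faithful B = ∀ a → InRange B a → ¬ Annihilates a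

-- Multiples a · x in a finite abelian group (written ⋆ here, with the group operation
-- written ∙ to keep + for natural numbers), and Lagrange's theorem |G| · x = 0.
module Multiples (G : FiniteAbelianGroup) where
  open FiniteAbelianGroup G hiding (_+_)
  open import Algebra.Definitions.RawMonoid rawMonoid using () renaming (_×_ to _×ₘ_)
  open import Algebra.Properties.Monoid.Mult monoid using (×-congʳ; ×-homo-+; ×-assocˡ)
  open import Algebra.Properties.CommutativeMonoid.Mult commutativeMonoid using (×-distrib-+)
  open import Algebra.Properties.CommutativeMonoid.Sum commutativeMonoid
    using (sum; sum-cong-≋; sum-permute; ∑-distrib-+; sum-replicate)
  open import Algebra.Properties.Group group using (identityˡ-unique)
  open import Relation.Binary.Reasoning.Setoid setoid

  infixr 8 _⋆_
  _⋆_ : ℕ → Carrier → Carrier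
  _⋆_ = _·_ G

  -- the multiples of Defs agree with the library's, whose laws we reuse
  ⋆≡× : ∀ a x → a ⋆ x ≡ a ×ₘ x
  ⋆≡× zero    x = ≡.refl
  ⋆≡× (suc a) x = ≡.cong (x ∙_) (⋆≡× a x)

  ⋆-cong : ∀ a {x y} → x ≈ y → a ⋆ x ≈ a ⋆ y
  ⋆-cong a {x} {y} x≈y rewrite ⋆≡× a x | ⋆≡× a y = ×-congʳ a x≈y

  ⋆-identity : ∀ x → 1 ⋆ x ≈ x
  ⋆-identity x = identityʳ x

  ⋆-zeroʳ : ∀ a → a ⋆ 0# ≈ 0#
  ⋆-zeroʳ zero    = refl
  ⋆-zeroʳ (suc a) = trans (identityˡ _) (⋆-zeroʳ a)

  ⋆-+ : ∀ a b x → (a + b) ⋆ x ≈ a ⋆ x ∙ b ⋆ x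
  ⋆-+ a b x rewrite ⋆≡× (a + b) x | ⋆≡× a x | ⋆≡× b x = ×-homo-+ x a b

  ⋆-assoc : ∀ a b x → a ⋆ (b ⋆ x) ≈ (a * b) ⋆ x
  ⋆-assoc a b x rewrite ⋆≡× b x | ⋆≡× a (b ×ₘ x) | ⋆≡× (a * b) x = ×-assocˡ x a b

  ⋆-distrib : ∀ a x y → a ⋆ (x ∙ y) ≈ a ⋆ x ∙ a ⋆ y
  ⋆-distrib a x y rewrite ⋆≡× a (x ∙ y) | ⋆≡× a x | ⋆≡× a y = ×-distrib-+ x y a

  ⋆-mod : ∀ n .{{_ : NonZero n}} {x} → n ⋆ x ≈ 0# → ∀ c → c ⋆ x ≈ (c % n) ⋆ x
  ⋆-mod n {x} n⋆x≈0 c = begin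
    c ⋆ x                                ≡⟨ ≡.cong (_⋆ x) (m≡m%n+[m/n]*n c n) ⟩
    (c % n + (c / n) * n) ⋆ x            ≈⟨ ⋆-+ (c % n) _ x ⟩
    (c % n) ⋆ x ∙ ((c / n) * n) ⋆ x      ≈⟨ ∙-congˡ (sym (⋆-assoc (c / n) n x)) ⟩
    (c % n) ⋆ x ∙ (c / n) ⋆ (n ⋆ x)      ≈⟨ ∙-congˡ (⋆-cong (c / n) n⋆x≈0) ⟩
    (c % n) ⋆ x ∙ (c / n) ⋆ 0#           ≈⟨ ∙-congˡ (⋆-zeroʳ (c / n)) ⟩
    (c % n) ⋆ x ∙ 0#                     ≈⟨ identityʳ _ ⟩
    (c % n) ⋆ x                          ∎

  ⋆-congruent : ∀ n .{{_ : NonZero n}} {x a b} → n ⋆ x ≈ 0# → a % n ≡ b % n → a ⋆ x ≈ b ⋆ x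
  ⋆-congruent n {x} {a} {b} n⋆x≈0 a≡b = begin
    a ⋆ x        ≈⟨ ⋆-mod n n⋆x≈0 a ⟩
    (a % n) ⋆ x  ≡⟨ ≡.cong (_⋆ x) a≡b ⟩
    (b % n) ⋆ x  ≈⟨ ⋆-mod n n⋆x≈0 b ⟨
    b ⋆ x        ∎

  ⋆-∣ : ∀ {d c x} → d ∣ c → d ⋆ x ≈ 0# → c ⋆ x ≈ 0#
  ⋆-∣ {d} {x = x} (divides q ≡.refl) d⋆x≈0 =
    trans (sym (⋆-assoc q d x)) (trans (⋆-cong q d⋆x≈0) (⋆-zeroʳ q))

  ⋆-cancel : ∀ {a b x} → a ≤ b → a ⋆ x ≈ b ⋆ x → (b ∸ a) ⋆ x ≈ 0#
  ⋆-cancel {a} {b} {x} a≤b a⋆x≈b⋆x = identityˡ-unique _ (a ⋆ x) (begin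
    (b ∸ a) ⋆ x ∙ a ⋆ x    ≈⟨ ⋆-+ (b ∸ a) a x ⟨
    ((b ∸ a) + a) ⋆ x      ≡⟨ ≡.cong (_⋆ x) (m∸n+n≡m a≤b) ⟩
    b ⋆ x                  ≈⟨ a⋆x≈b⋆x ⟨
    a ⋆ x                  ∎)

  coprime-annihilators : ∀ {a b x} .{{_ : NonZero a}} → Coprime a b →
                         a ⋆ x ≈ 0# → b ⋆ x ≈ 0# → x ≈ 0#
  coprime-annihilators {a} {b} {x} a⊥b a⋆x≈0 b⋆x≈0 with crt a b a⊥b
  ... | c , c≡1 , b∣c = begin
    x      ≈⟨ ⋆-identity x ⟨
    1 ⋆ x  ≈⟨ ⋆-congruent a a⋆x≈0 c≡1 ⟨
    c ⋆ x  ≈⟨ ⋆-∣ b∣c b⋆x≈0 ⟩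
    0#     ∎

  faithful⇒injective : ∀ {B a b} → Faithful G B → InRange B a → InRange B b →
                       (∀ x → a ⋆ x ≈ b ⋆ x) → a ≡ b
  faithful⇒injective {B} {a} {b} faithful a-range b-range a≈b with <-cmp a b
  ... | tri≈ _ a≡b _ = a≡b
  ... | tri< a<b _ _ = ⊥-elim (faithful (b ∸ a) (difference-range {B} a<b b-range)
                                 (λ x → ⋆-cancel (<⇒≤ a<b) (a≈b x)))
  ... | tri> _ _ b<a = ⊥-elim (faithful (a ∸ b) (difference-range {B} b<a a-range)
                                 (λ x → ⋆-cancel (<⇒≤ b<a) (sym (a≈b x))))

  order-nonZero : NonZero (order G)
  order-nonZero = any⇒nonZero (complete 0#)

  trivial⇒order≤1 : (∀ x → x ≈ 0#) → order G ≤ 1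
  trivial⇒order≤1 all-zero = at-most-one elems distinct
    where
    at-most-one : ∀ xs → AllPairs (λ x y → ¬ (x ≈ y)) xs → length xs ≤ 1
    at-most-one []               _                 = z≤n
    at-most-one (_ ∷ [])         _                 = s≤s z≤n
    at-most-one (x ∷ y ∷ _)      ((x≉y ∷ _) ∷ _)   = ⊥-elim (x≉y (trans (all-zero x) (sym (all-zero y))))

  element : Fin (order G) → Carrier
  element = lookup elems

  indexOf : Carrier → Fin (order G)
  indexOf x = Any.index (complete x)

  element-indexOf : ∀ x → x ≈ element (indexOf x)
  element-indexOf x = lookup-index (complete x)

  translate-cancel : ∀ {u v} → u ∙ v ≈ ε → ∀ j → indexOf (u ∙ element (indexOf (v ∙ element j))) ≡ j
  translate-cancel {u} {v} u∙v≈ε j = lookup-injective setoid elems distinct (begin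
    element (indexOf (u ∙ element (indexOf (v ∙ element j))))  ≈⟨ element-indexOf _ ⟨
    u ∙ element (indexOf (v ∙ element j))                      ≈⟨ ∙-congˡ (element-indexOf _) ⟨
    u ∙ (v ∙ element j)                                        ≈⟨ assoc u v _ ⟨
    (u ∙ v) ∙ element j                                        ≈⟨ ∙-congʳ u∙v≈ε ⟩
    ε ∙ element j                                              ≈⟨ identityˡ _ ⟩
    element j                                                  ∎)

  translation : Carrier → Permutation (order G) (order G)
  translation y = permutation (λ j → indexOf (y ∙ element j)) (λ j → indexOf (y ⁻¹ ∙ element j))
                              (translate-cancel (inverseʳ y)) (translate-cancel (inverseˡ y))

  -- Lagrange: |G| annihilates G (summing all elements before and after translating by y)
  lagrange : Annihilates G (order G)
  lagrange y = identityˡ-unique (order G ⋆ y) (sum element) (sym (begin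
    sum element                                        ≈⟨ sum-permute element (translation y) ⟩
    sum (λ j → element (indexOf (y ∙ element j)))      ≈⟨ sum-cong-≋ (λ j → element-indexOf (y ∙ element j)) ⟨
    sum (λ j → y ∙ element j)                          ≈⟨ ∑-distrib-+ (λ _ → y) element ⟩
    sum {order G} (λ _ → y) ∙ sum element              ≈⟨ ∙-congʳ (sum-replicate (order G)) ⟩
    order G ×ₘ y ∙ sum element                         ≡⟨ ≡.cong (_∙ sum element) (⋆≡× (order G) y) ⟨
    order G ⋆ y ∙ sum element                          ∎))

  sumFin-cong : ∀ L {f g : Fin L → Carrier} → (∀ j → f j ≈ g j) → sumFin G L f ≈ sumFin G L g
  sumFin-cong zero    f≈g = refl
  sumFin-cong (suc L) f≈g = ∙-cong (f≈g Fin.zero) (sumFin-cong L (λ j → f≈g (Fin.suc j)))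

-- Faithfulness of the two kinds of factors occurring in the theorem: a group is
-- faithful up to its exponent, and ℤ_p is faithful up to p (a weight in [1, p - 1]
-- annihilating a generator would make the group trivial).
exponent⇒faithful : ∀ (K : FiniteAbelianGroup) {B} → IsExponent K B → Faithful K B
exponent⇒faithful K (_ , _ , least) a a-range@(1≤a , _) a-kills =
  <⇒≱ (inRange⇒< a-range) (least a 1≤a a-kills)

cyclic-prime⇒faithful : ∀ (C : FiniteAbelianGroup) {p} → Prime p → IsCyclicOfOrder C p → Faithful C p
cyclic-prime⇒faithful C {p} p-prime (|C|≡p , g , generates) a a-range@(1≤a , _) a-kills =
  <⇒≱ (prime>1 p-prime) (≡.subst (_≤ 1) |C|≡p (trivial⇒order≤1 all-zero))
  where
  open FiniteAbelianGroup C
  open Multiples C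
  instance
    p≢0 : NonZero p
    p≢0 = prime⇒nonZero p-prime
    a≢0 : NonZero a
    a≢0 = >-nonZero 1≤a
  -- g is killed by p (Lagrange) and by a, which is coprime to p
  g≈0 : g ≈ 0#
  g≈0 = coprime-annihilators (prime⇒coprime p-prime (inRange⇒< a-range))
          (≡.subst (λ q → q ⋆ g ≈ 0#) |C|≡p (lagrange g)) (a-kills g)
  all-zero : ∀ x → x ≈ 0#
  all-zero x with generates x
  ... | j , x≈j⋆g = trans x≈j⋆g (trans (⋆-cong j g≈0) (⋆-zeroʳ j))

module Homomorphism (G K : FiniteAbelianGroup)
  (φ : FiniteAbelianGroup.Carrier G → FiniteAbelianGroup.Carrier K)
  (φ-cong : ∀ {x y} → FiniteAbelianGroup._≈_ G x y → FiniteAbelianGroup._≈_ K (φ x) (φ y))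
  (φ-+ : ∀ x y → FiniteAbelianGroup._≈_ K (φ (FiniteAbelianGroup._+_ G x y))
                                          (FiniteAbelianGroup._+_ K (φ x) (φ y))) where
  private module G = FiniteAbelianGroup G
  open FiniteAbelianGroup K hiding (_+_)
  open Multiples K
  open import Algebra.Properties.Group group using (identityˡ-unique)

  φ-0 : φ G.0# ≈ 0#
  φ-0 = identityˡ-unique (φ G.0#) (φ G.0#) (trans (sym (φ-+ G.0# G.0#)) (φ-cong (G.identityˡ G.0#)))

  φ-⋆ : ∀ a x → φ (_·_ G a x) ≈ a ⋆ φ x
  φ-⋆ zero    x = φ-0
  φ-⋆ (suc a) x = trans (φ-+ x _) (∙-congˡ (φ-⋆ a x))

  φ-sumFin : ∀ L (f : Fin L → G.Carrier) → φ (sumFin G L f) ≈ sumFin K L (λ j → φ (f j))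
  φ-sumFin zero    f = φ-0
  φ-sumFin (suc L) f = trans (φ-+ _ _) (∙-congˡ (φ-sumFin L (λ j → f (Fin.suc j))))

  annihilates-image : (∀ y → ∃[ x ] φ x ≈ y) → ∀ {a} → Annihilates G a → Annihilates K a
  annihilates-image surjective {a} a-kills y with surjective y
  ... | x , φx≈y = trans (⋆-cong a (sym φx≈y)) (trans (sym (φ-⋆ a x)) (trans (φ-cong (a-kills x)) φ-0))

module Scaling (K : FiniteAbelianGroup) (c : ℕ) =
  Homomorphism K K (Multiples._⋆_ K c) (Multiples.⋆-cong K c) (Multiples.⋆-distrib K c)

-- If |Hᵢ| is coprime to every other |Hₗ|, some integer acts as the identity on Hᵢ and
-- annihilates every other factor: take c ≡ 1 (mod |Hᵢ|) divisible by ∏_{l ≠ i} |Hₗ|.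
component-selector : ∀ {r} (H : Fin r → FiniteAbelianGroup) (i : Fin r) →
                     (∀ l → l ≢ i → Coprime (order (H i)) (order (H l))) →
                     ∃[ c ] Fixes (H i) c × (∀ l → l ≢ i → Annihilates (H l) c)
component-selector {suc r} H i orders⊥ = selector (crt P Q P⊥Q)
  where
  P : ℕ
  P = order (H i)
  instance
    P≢0 : NonZero P
    P≢0 = Multiples.order-nonZero (H i)

  Q : ℕ
  Q = ∏ (removeAt (λ l → order (H l)) i)

  P⊥Q : Coprime P Q
  P⊥Q = ⊥-∏ _ (λ j → orders⊥ (Fin.punchIn i j) (FinP.punchInᵢ≢i i j))

  |Hₗ|∣Q : ∀ l → l ≢ i → order (H l) ∣ Q
  |Hₗ|∣Q l l≢i = ≡.subst (λ l′ → order (H l′) ∣ Q) (FinP.punchIn-punchOut i≢l) (∣-∏ _ (Fin.punchOut i≢l))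
    where
    i≢l : i ≢ l
    i≢l i≡l = l≢i (≡.sym i≡l)

  selector : ∃[ c ] (c % P ≡ 1 % P) × (Q ∣ c) → ∃[ c ] Fixes (H i) c × (∀ l → l ≢ i → Annihilates (H l) c)
  selector (c , c≡1 , Q∣c) =
    c , (λ y → FiniteAbelianGroup.trans (H i) (Multiples.⋆-congruent (H i) P (Multiples.lagrange (H i) y) c≡1)
                                                (Multiples.⋆-identity (H i) y))
      , (λ l l≢i z → Multiples.⋆-∣ (H l) (∣-trans (|Hₗ|∣Q l l≢i) Q∣c) (Multiples.lagrange (H l) z))

p-groups⊥ : ∀ (K K′ : FiniteAbelianGroup) {p q} → Prime p → Prime q → p ≢ q →
            IsPGroup K p → IsPGroup K′ q → Coprime (order K) (order K′)
p-groups⊥ K K′ p-prime q-prime p≢q (e , |K|≡pᵉ) (f , |K′|≡qᶠ) rewrite |K|≡pᵉ | |K′|≡qᶠ =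
  coprime-^ˡ (Coprimality.sym (coprime-^ˡ (Coprimality.sym (distinct-primes⊥ p-prime q-prime p≢q)) f)) e

module Decomposition {r} (G : FiniteAbelianGroup) (H : Fin r → FiniteAbelianGroup)
  (φ : ∀ l → FiniteAbelianGroup.Carrier G → FiniteAbelianGroup.Carrier (H l))
  (φ-cong : ∀ l {x y} → FiniteAbelianGroup._≈_ G x y → FiniteAbelianGroup._≈_ (H l) (φ l x) (φ l y))
  (φ-+ : ∀ l x y → FiniteAbelianGroup._≈_ (H l) (φ l (FiniteAbelianGroup._+_ G x y))
                     (FiniteAbelianGroup._+_ (H l) (φ l x) (φ l y)))
  (φ-injective : ∀ x y → (∀ l → FiniteAbelianGroup._≈_ (H l) (φ l x) (φ l y)) → FiniteAbelianGroup._≈_ G x y)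
  (φ-surjective : ∀ (t : (l : Fin r) → FiniteAbelianGroup.Carrier (H l)) →
                    ∃[ x ] ∀ l → FiniteAbelianGroup._≈_ (H l) (φ l x) (t l)) where
  private
    module G = FiniteAbelianGroup G
    module Hₗ (l : Fin r) = FiniteAbelianGroup (H l)
    module φₗ (l : Fin r) = Homomorphism G (H l) (φ l) (φ-cong l) (φ-+ l)

  infixr 8 _⋆[_]_
  _⋆[_]_ : ℕ → (l : Fin r) → Hₗ.Carrier l → Hₗ.Carrier l
  a ⋆[ l ] y = _·_ (H l) a y

  -- each coordinate map is surjective: lift the tuple with y at position l and 0 elsewhere
  single : ∀ l → Hₗ.Carrier l → ∀ l' → Hₗ.Carrier l'
  single l y l' with l' Fin.≟ l
  ... | yes ≡.refl = y
  ... | no _       = Hₗ.0# l'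

  single-at : ∀ l y → Hₗ._≈_ l (single l y l) y
  single-at l y with l Fin.≟ l
  ... | yes ≡.refl = Hₗ.refl l
  ... | no l≢l     = ⊥-elim (l≢l ≡.refl)

  φ-surjectiveₗ : ∀ l y → ∃[ x ] Hₗ._≈_ l (φ l x) y
  φ-surjectiveₗ l y with φ-surjective (single l y)
  ... | x , φx≈ = x , Hₗ.trans l (φx≈ l) (single-at l y)

  annihilates-factor : ∀ {a} → Annihilates G a → ∀ l → Annihilates (H l) a
  annihilates-factor {a} a-kills l = φₗ.annihilates-image l (φ-surjectiveₗ l) {a} a-kills

  module Transfer (n : ℕ) .{{_ : NonZero n}} (n-kills : Annihilates G n) (i : Fin r) (c : ℕ)
                  (c-fixes : Fixes (H i) c) (c-kills : ∀ l → l ≢ i → Annihilates (H l) c) where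

    weight : ℕ → ℕ
    weight a = (c * a) % n

    -- on every factor, weight a acts as c · a (n annihilates each factor)
    weight-action : ∀ l a y → Hₗ._≈_ l (weight a ⋆[ l ] y) (c ⋆[ l ] a ⋆[ l ] y)
    weight-action l a y = Hₗ.sym l (Hₗ.trans l (Multiples.⋆-assoc (H l) c a y)
                            (Multiples.⋆-mod (H l) n (annihilates-factor {n} n-kills l y) (c * a)))

    weight-actsᵢ : ∀ a y → Hₗ._≈_ i (weight a ⋆[ i ] y) (a ⋆[ i ] y)
    weight-actsᵢ a y = Hₗ.trans i (weight-action i a y) (c-fixes (a ⋆[ i ] y))

    summand-transfer : ∀ l {L} (w : Fin L → Maybe ℕ) (x : Fin L → G.Carrier) j →
      Hₗ._≈_ l (φ l (term G (λ j → Maybe.map weight (w j)) x j))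
               (c ⋆[ l ] term (H l) w (λ j → φ l (x j)) j)
    summand-transfer l w x j with w j
    ... | nothing = Hₗ.trans l (φₗ.φ-0 l) (Hₗ.sym l (Multiples.⋆-zeroʳ (H l) c))
    ... | just a  = Hₗ.trans l (φₗ.φ-⋆ l (weight a) (x j)) (weight-action l a (φ l (x j)))

    sum-transfer : ∀ l {L} (w : Fin L → Maybe ℕ) (x : Fin L → G.Carrier) →
      Hₗ._≈_ l (φ l (sumFin G L (term G (λ j → Maybe.map weight (w j)) x)))
               (c ⋆[ l ] sumFin (H l) L (term (H l) w (λ j → φ l (x j))))
    sum-transfer l {L} w x =
      Hₗ.trans l (φₗ.φ-sumFin l L _)
        (Hₗ.trans l (Multiples.sumFin-cong (H l) L (summand-transfer l w x))
          (Hₗ.sym l (Scaling.φ-sumFin (H l) c L _)))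

    zero-sum-transfer : ∀ {A L} {x : Fin L → G.Carrier} →
                        HasWeightedZeroSubsum (H i) A L (λ j → φ i (x j)) →
                        HasWeightedZeroSubsum G (map weight A) L x
    zero-sum-transfer {A} {L} {x} (w , (j₀ , a₀ , w-j₀) , w-in-A , sum≈0) =
      w′ , (j₀ , weight a₀ , ≡.cong (Maybe.map weight) w-j₀) , w′-in-weights , G-sum≈0
      where
      w′ : Fin L → Maybe ℕ
      w′ j = Maybe.map weight (w j)

      w′-in-weights : ∀ j b → w′ j ≡ just b → b ∈ map weight A
      w′-in-weights j b with w j in w-j
      ... | just a  = λ { ≡.refl → ∈-map⁺ weight (w-in-A j a w-j) }
      ... | nothing = λ ()

      coordinate-vanishes : ∀ l → Hₗ._≈_ l (c ⋆[ l ] sumFin (H l) L (term (H l) w (λ j → φ l (x j))))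
                                           (Hₗ.0# l)
      coordinate-vanishes l with l Fin.≟ i
      ... | yes ≡.refl = Hₗ.trans i (Multiples.⋆-cong (H i) c sum≈0) (Multiples.⋆-zeroʳ (H i) c)
      ... | no l≢i     = c-kills l l≢i _

      G-sum≈0 : G._≈_ (sumFin G L (term G w′ x)) G.0#
      G-sum≈0 = φ-injective _ _ λ l →
        Hₗ.trans l (sum-transfer l w x) (Hₗ.trans l (coordinate-vanishes l) (Hₗ.sym l (φₗ.φ-0 l)))

    davenport-transfer : ∀ {A k} → DavenportProp (H i) A k → DavenportProp G (map weight A) k
    davenport-transfer davenport x = zero-sum-transfer (davenport (λ j → φ i (x j)))

    module _ (B : ℕ) (faithful : Faithful (H i) B) where

      weight-injective : ∀ {a b} → InRange B a → InRange B b → weight a ≡ weight b → a ≡ b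
      weight-injective {a} {b} a-range b-range wa≡wb =
        Multiples.faithful⇒injective (H i) {B} faithful a-range b-range λ y →
          Hₗ.trans i (Hₗ.sym i (weight-actsᵢ a y))
            (Hₗ.trans i (Hₗ.reflexive i (≡.cong (_⋆[ i ] y) wa≡wb)) (weight-actsᵢ b y))

      weight-inRange : ∀ {a} → InRange B a → InRange n (weight a)
      weight-inRange {a} a-range = n≢0⇒n>0 weight≢0 , <⇒≤pred (m%n<n (c * a) n)
        where
        weight≢0 : weight a ≢ 0
        weight≢0 wa≡0 = faithful a a-range λ y →
          Hₗ.trans i (Hₗ.sym i (weight-actsᵢ a y)) (Hₗ.reflexive i (≡.cong (_⋆[ i ] y) wa≡0))

      fD-transfer : ∀ {k m} → fD≤ (H i) B k m → fD≤ G n k m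
      fD-transfer {k} {m} (A , A≢[] , A-unique , A-range , |A|≤m , k′ , 1≤k′ , k′≤k , davenport) =
        map weight A , map-≢[] A≢[] , map-unique weight-injective A-range A-unique ,
        All.map⁺ (All.map weight-inRange A-range) ,
        ≡.subst (_≤ m) (≡.sym (length-map weight A)) |A|≤m ,
        k′ , 1≤k′ , k′≤k , davenport-transfer davenport

-- First statement: f_G(k) ≤ f_{Hᵢ}(k) for each p-group factor Hᵢ of G
-- (the argument does not need k ≥ 2).
product-of-p-groups :
  ∀ (r : ℕ) (p : Fin r → ℕ) (H : Fin r → FiniteAbelianGroup) (G : FiniteAbelianGroup)
    → (∀ i → Prime (p i))
    → (∀ i j → i Fin.< j → p i < p j)
    → (∀ i → IsPGroup (H i) (p i))
    → IsProductOf G H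
    → ∀ n → IsExponent G n
    → ∀ k → 2 ≤ k
    → ∀ i nᵢ → IsExponent (H i) nᵢ
    → ∀ m → fD≤ (H i) nᵢ k m → fD≤ G n k m
product-of-p-groups r p H G primes increasing p-groups (φ , φ-cong , φ-+ , φ-inj , φ-surj)
                    n (n≥1 , n-kills , _) k _ i nᵢ expᵢ m =
  let c , c-fixes , c-kills = component-selector H i orders⊥
  in Transfer.fD-transfer n n-kills i c c-fixes c-kills nᵢ (exponent⇒faithful (H i) expᵢ)
  where
  open Decomposition G H φ φ-cong φ-+ φ-inj φ-surj
  instance
    n≢0 : NonZero n
    n≢0 = >-nonZero n≥1
  orders⊥ : ∀ l → l ≢ i → Coprime (order (H i)) (order (H l))
  orders⊥ l l≢i = p-groups⊥ (H i) (H l) (primes i) (primes l)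
                    (increasing⇒injective p increasing (λ i≡l → l≢i (≡.sym i≡l)))
                    (p-groups i) (p-groups l)

-- Second statement: f_G(k) ≤ f(p, k) when G = ℤ_p × H with p ∤ |H|; the factor ℤ_p
-- is index zero of the pair, and its weights are compared with [1, p - 1].
prime-cyclic-factor :
  ∀ (p : ℕ) (C H G : FiniteAbelianGroup)
    → Prime p
    → IsCyclicOfOrder C p
    → ¬ (p ∣ order H)
    → IsProductOf G (pair C H)
    → ∀ n → IsExponent G n
    → ∀ k → 2 ≤ k
    → ∀ m → fD≤ C p k m → fD≤ G n k m
prime-cyclic-factor p C H G p-prime C-cyclic@(|C|≡p , _) p∤|H| (φ , φ-cong , φ-+ , φ-inj , φ-surj)
                    n (n≥1 , n-kills , _) k _ m =
  let c , c-fixes , c-kills = component-selector (pair C H) Fin.zero orders⊥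
  in Transfer.fD-transfer n n-kills Fin.zero c c-fixes c-kills p (cyclic-prime⇒faithful C p-prime C-cyclic)
  where
  open Decomposition G (pair C H) φ φ-cong φ-+ φ-inj φ-surj
  instance
    n≢0 : NonZero n
    n≢0 = >-nonZero n≥1
  orders⊥ : ∀ l → l ≢ Fin.zero → Coprime (order C) (order (pair C H l))
  orders⊥ Fin.zero            0≢0 = ⊥-elim (0≢0 ≡.refl)
  orders⊥ (Fin.suc Fin.zero)  _   = ≡.subst (λ q → Coprime q (order H)) (≡.sym |C|≡p) (prime⊥ p-prime p∤|H|)

proposition1 :
    (∀ (r : ℕ) (p : Fin r → ℕ) (H : Fin r → FiniteAbelianGroup) (G : FiniteAbelianGroup)
       → (∀ i → Prime (p i))
       → (∀ i j → i Fin.< j → p i < p j)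
       → (∀ i → IsPGroup (H i) (p i))
       → IsProductOf G H
       → ∀ n → IsExponent G n
       → ∀ k → 2 ≤ k
       → ∀ i nᵢ → IsExponent (H i) nᵢ
       → ∀ m → fD≤ (H i) nᵢ k m → fD≤ G n k m)
    ×
    (∀ (p : ℕ) (C H G : FiniteAbelianGroup)
       → Prime p
       → IsCyclicOfOrder C p
       → ¬ (p ∣ order H)
       → IsProductOf G (pair C H)
       → ∀ n → IsExponent G n
       → ∀ k → 2 ≤ k
       → ∀ m → fD≤ C p k m → fD≤ G n k m)
proposition1 = product-of-p-groups , prime-cyclic-factor
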